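{- Let $G$ be a binary quasigroup of order $n$. Then for every tuple $V\in\mathcal U_1$ we have $\Pi(V)\in P^\infty(G)$.
   Context: Let $\mathcal I_n=\{1,\dots,n\}$. A binary quasigroup $G$ of order $n$ is the set $\mathcal I_n$ with an operation $*$ such that for all $a_0,a_1,a_2$ there are unique $x_1,x_2$ with $a_1*x_2=a_0$ and $x_1*a_2=a_0$. Elements of $\mathcal I_n^n$ are tuples; $*$ acts on tuples entrywise. A permutation is a tuple with pairwise distinct entries; $\mathcal W$ is the set of permutations and $\mathbb W=(1,\dots,n)$. For $d\ge0$, a $U$-diagonal of type $V$ in $G[d]$ is a sequence $(W_1,\dots,W_d)\in\mathcal W^d$ with $(\cdots((U*W_1)*W_2)*\cdots)*W_d=V$ entrywise. Tuples $U,V$ are equivalent if for some $d\ge0$ there is a $U$-diagonal of type $V$ in $G[d]$; $\mathcal U_1$ denotes the equivalence class containing $\mathbb W$. For $V=(v_1,\dots,v_k)$, $\Pi(V)=(\cdots(v_1*v_2)*\cdots)*v_k$. $P^k(G)$ is the set of elements of $G$ admitting a factorization (ordered and bracketed in any way) that contains every element of $G$ exactly $k$ times, and $P^\infty(G)=\bigcup_{k\ge1}P^k(G)$. -}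

module Defs where

open import Data.Nat using (ℕ; zero; suc; _≥_)
open import Data.Fin using (Fin; zero; suc; inject₁; fromℕ)
open import Data.Fin.Properties using (_≟_)
open import Data.Product using (Σ; ∃; ∃-syntax; ∃!; _×_; _,_)
open import Data.List using (List; []; _∷_; _++_; length; filter)
open import Data.Vec using (Vec; []; _∷_)
open import Function.Definitions using (Injective)
open import Relation.Binary.PropositionalEquality using (_≡_)

Op : ℕ → Set
Op n = Fin n → Fin n → Fin n

record IsBinaryQuasigroup {n : ℕ} (_*_ : Op n) : Set where
  field
    leftSolvable  : ∀ a₀ a₁ → ∃! _≡_ (λ x₂ → (a₁ * x₂) ≡ a₀)
    rightSolvable : ∀ a₀ a₂ → ∃! _≡_ (λ x₁ → (x₁ * a₂) ≡ a₀)

-- Tuples: elements of I_n^n, as functions Fin n → Fin n.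
Tuple : ℕ → Set
Tuple n = Fin n → Fin n

_⟨_⟩_ : {n : ℕ} → Tuple n → Op n → Tuple n → Tuple n
(U ⟨ _*_ ⟩ W) i = U i * W i

IsPermutation : {n : ℕ} → Tuple n → Set
IsPermutation W = Injective _≡_ _≡_ W

𝕎 : {n : ℕ} → Tuple n
𝕎 i = i

applyDiag : {n d : ℕ} → Op n → Tuple n → Vec (Tuple n) d → Tuple n
applyDiag _*_ U []       = U
applyDiag _*_ U (W ∷ Ws) = applyDiag _*_ (U ⟨ _*_ ⟩ W) Ws

AllPermutations : {n d : ℕ} → Vec (Tuple n) d → Set
AllPermutations []       = Data.Unit.⊤ where import Data.Unit
AllPermutations (W ∷ Ws) = IsPermutation W × AllPermutations Ws

IsDiagonal : {n : ℕ} → Op n → (d : ℕ) → Tuple n → Tuple n → Vec (Tuple n) d → Set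
IsDiagonal _*_ d U V Ws = AllPermutations Ws × (∀ i → applyDiag _*_ U Ws i ≡ V i)

Equivalent : {n : ℕ} → Op n → Tuple n → Tuple n → Set
Equivalent _*_ U V = ∃[ d ] Σ (Vec _ d) (IsDiagonal _*_ d U V)

In𝒰₁ : {n : ℕ} → Op n → Tuple n → Set
In𝒰₁ _*_ V = Equivalent _*_ 𝕎 V

Π : {A : Set} → (A → A → A) → (k : ℕ) → (Fin (suc k) → A) → A
Π _*_ zero    V = V zero
Π _*_ (suc k) V = Π _*_ k (λ i → V (inject₁ i)) * V (fromℕ (suc k))

-- Arbitrary bracketed, ordered factorizations: binary trees with leaves in I_n.
data Factorization (n : ℕ) : Set where
  leaf : Fin n → Factorization n
  node : Factorization n → Factorization n → Factorization n

eval : {n : ℕ} → Op n → Factorization n → Fin n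
eval _*_ (leaf a)   = a
eval _*_ (node s t) = eval _*_ s * eval _*_ t

leaves : {n : ℕ} → Factorization n → List (Fin n)
leaves (leaf a)   = a ∷ []
leaves (node s t) = leaves s ++ leaves t

occurrences : {n : ℕ} → Fin n → Factorization n → ℕ
occurrences a t = length (filter (_≟ a) (leaves t))

InP : {n : ℕ} → Op n → ℕ → Fin n → Set
InP {n} _*_ k x = Σ (Factorization n) λ t → (eval _*_ t ≡ x) × (∀ a → occurrences a t ≡ k)

InP∞ : {n : ℕ} → Op n → Fin n → Set
InP∞ _*_ x = ∃[ k ] (k ≥ 1 × InP _*_ k x)

-- Start from the one-leaf factorizations
-- of 1, …, n, which evaluate to 𝕎, and follow a diagonal (W₁, …, W_d) of type V:
-- step j multiplies the i-th factorization on the right by the leaf W_j(i).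
-- The i-th factorization then evaluates to V(i), and since W_j is a permutation,
-- each step adds exactly one occurrence of every element to the whole family.
-- Multiplying the n factorizations with the bracketing of Π gives a factorization
-- of Π(V) in which every element occurs d + 1 times.
module Submission where

open import Defs
open import Data.Nat using (ℕ; suc; _+_; s≤s; z≤n)
open import Data.Nat.Properties using (+-0-commutativeMonoid; +-identityʳ; +-assoc; 1+n≰n)
open import Data.Fin using (Fin; zero; inject₁; fromℕ; punchIn; punchOut)
open import Data.Fin.Properties using (_≟_; any?; injective⇒≤; punchOut-injective; punchInᵢ≢i)
open import Data.List using (filter)
open import Data.List.Properties using (length-++; filter-++)
open import Data.Vec using (Vec; []; _∷_)
open import Data.Product using (∃; _,_)
open import Function.Definitions using (Injective)
open import Relation.Nullary using (yes; no)
open import Relation.Nullary.Negation using (contradiction)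
open import Relation.Binary.PropositionalEquality
open import Algebra.Properties.CommutativeMonoid.Sum +-0-commutativeMonoid
  using (sum-syntax; sum-cong-≗; sum-init-last; sum-remove; ∑-distrib-+; sum-replicate-zero)

injective⇒surjective : ∀ {n} {f : Fin (suc n) → Fin (suc n)} → Injective _≡_ _≡_ f →
                       ∀ a → ∃ λ i → f i ≡ a
injective⇒surjective {n} {f} f-inj a with any? (λ i → f i ≟ a)
... | yes hit = hit
... | no miss = contradiction (injective⇒≤ punchOut-a-injective) 1+n≰n
  where
  a≢f : ∀ i → a ≢ f i
  a≢f i a≡fi = miss (i , sym a≡fi)
  punchOut-a-injective : Injective _≡_ _≡_ (λ i → punchOut (a≢f i))
  punchOut-a-injective eq = f-inj (punchOut-injective (a≢f _) (a≢f _) eq)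

occurrences-leaf-≡ : ∀ {n} (a : Fin n) → occurrences a (leaf a) ≡ 1
occurrences-leaf-≡ a with a ≟ a
... | yes _   = refl
... | no a≢a = contradiction refl a≢a

occurrences-leaf-≢ : ∀ {n} {a b : Fin n} → b ≢ a → occurrences a (leaf b) ≡ 0
occurrences-leaf-≢ {a = a} {b} b≢a with b ≟ a
... | yes b≡a = contradiction b≡a b≢a
... | no _    = refl

occurrences-node : ∀ {n} (a : Fin n) s t →
                   occurrences a (node s t) ≡ occurrences a s + occurrences a t
occurrences-node a s t rewrite filter-++ (_≟ a) (leaves s) (leaves t) =
  length-++ (filter (_≟ a) (leaves s))

∑-occurrences-permutation : ∀ {m} (W : Tuple (suc m)) → IsPermutation W →
                            ∀ a → ∑[ i < suc m ] occurrences a (leaf (W i)) ≡ 1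
∑-occurrences-permutation {m} W W-inj a with injective⇒surjective W-inj a
... | i₀ , W-i₀≡a = begin
  ∑[ i < suc m ] occurrences a (leaf (W i))
    ≡⟨ sum-remove {i = i₀} (λ i → occurrences a (leaf (W i))) ⟩
  occurrences a (leaf (W i₀)) + ∑[ j < m ] occurrences a (leaf (W (punchIn i₀ j)))
    ≡⟨ cong₂ _+_ (trans (cong (λ b → occurrences a (leaf b)) W-i₀≡a) (occurrences-leaf-≡ a))
                 (trans (sum-cong-≗ others-absent) (sum-replicate-zero m)) ⟩
  1 ∎
  where
  open ≡-Reasoning
  others-absent : ∀ j → occurrences a (leaf (W (punchIn i₀ j))) ≡ 0
  others-absent j = occurrences-leaf-≢ λ eq →
    punchInᵢ≢i i₀ j (W-inj (trans eq (sym W-i₀≡a)))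

leftProduct : ∀ {n} k → (Fin (suc k) → Factorization n) → Factorization n
leftProduct 0       f = f zero
leftProduct (suc k) f = node (leftProduct k (λ i → f (inject₁ i))) (f (fromℕ (suc k)))

eval-leftProduct : ∀ {n} (_*_ : Op n) k f (V : Fin (suc k) → Fin n) →
                   (∀ i → eval _*_ (f i) ≡ V i) → eval _*_ (leftProduct k f) ≡ Π _*_ k V
eval-leftProduct _*_ 0       f V f≗V = f≗V zero
eval-leftProduct _*_ (suc k) f V f≗V =
  cong₂ _*_ (eval-leftProduct _*_ k _ _ (λ i → f≗V (inject₁ i))) (f≗V (fromℕ (suc k)))

occurrences-leftProduct : ∀ {n} (a : Fin n) k f →
  occurrences a (leftProduct k f) ≡ ∑[ i < suc k ] occurrences a (f i)
occurrences-leftProduct a 0       f = sym (+-identityʳ _)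
occurrences-leftProduct a (suc k) f = begin
  occurrences a (leftProduct (suc k) f)
    ≡⟨ occurrences-node a (leftProduct k (λ i → f (inject₁ i))) (f (fromℕ (suc k))) ⟩
  occurrences a (leftProduct k (λ i → f (inject₁ i))) + occurrences a (f (fromℕ (suc k)))
    ≡⟨ cong (_+ occurrences a (f (fromℕ (suc k)))) (occurrences-leftProduct a k _) ⟩
  ∑[ i < suc k ] occurrences a (f (inject₁ i)) + occurrences a (f (fromℕ (suc k)))
    ≡⟨ sym (sum-init-last (λ i → occurrences a (f i))) ⟩
  ∑[ i < suc (suc k) ] occurrences a (f i) ∎
  where open ≡-Reasoning

diagonalFactorizations : ∀ {n d} → (Fin n → Factorization n) → Vec (Tuple n) d →
                         Fin n → Factorization n
diagonalFactorizations u []       = u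
diagonalFactorizations u (W ∷ Ws) = diagonalFactorizations (λ i → node (u i) (leaf (W i))) Ws

eval-diagonalFactorizations : ∀ {n d} (_*_ : Op n) u (Ws : Vec (Tuple n) d) i →
  eval _*_ (diagonalFactorizations u Ws i) ≡ applyDiag _*_ (λ j → eval _*_ (u j)) Ws i
eval-diagonalFactorizations _*_ u []       i = refl
eval-diagonalFactorizations _*_ u (W ∷ Ws) i = eval-diagonalFactorizations _*_ _ Ws i

∑-occurrences-diagonalFactorizations :
  ∀ {m d} u (Ws : Vec (Tuple (suc m)) d) → AllPermutations Ws → ∀ a →
  ∑[ i < suc m ] occurrences a (diagonalFactorizations u Ws i) ≡
  ∑[ i < suc m ] occurrences a (u i) + d
∑-occurrences-diagonalFactorizations u [] _ a = sym (+-identityʳ _)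
∑-occurrences-diagonalFactorizations {m} {suc d} u (W ∷ Ws) (W-perm , Ws-perm) a = begin
  ∑[ i < suc m ] occurrences a (diagonalFactorizations (λ i → node (u i) (leaf (W i))) Ws i)
    ≡⟨ ∑-occurrences-diagonalFactorizations _ Ws Ws-perm a ⟩
  ∑[ i < suc m ] occurrences a (node (u i) (leaf (W i))) + d
    ≡⟨ cong (_+ d) (sum-cong-≗ (λ i → occurrences-node a (u i) (leaf (W i)))) ⟩
  ∑[ i < suc m ] (occurrences a (u i) + occurrences a (leaf (W i))) + d
    ≡⟨ cong (_+ d) (∑-distrib-+ (λ i → occurrences a (u i)) (λ i → occurrences a (leaf (W i)))) ⟩
  ∑[ i < suc m ] occurrences a (u i) + ∑[ i < suc m ] occurrences a (leaf (W i)) + d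
    ≡⟨ cong (λ c → ∑[ i < suc m ] occurrences a (u i) + c + d)
            (∑-occurrences-permutation W W-perm a) ⟩
  ∑[ i < suc m ] occurrences a (u i) + 1 + d
    ≡⟨ +-assoc _ 1 d ⟩
  ∑[ i < suc m ] occurrences a (u i) + suc d ∎
  where open ≡-Reasoning

proposition5 : (m : ℕ) (_*_ : Op (suc m)) → IsBinaryQuasigroup _*_ →
               (V : Tuple (suc m)) → In𝒰₁ _*_ V → InP∞ _*_ (Π _*_ m V)
proposition5 m _*_ _ V (d , Ws , Ws-perm , 𝕎⇝V) =
  suc d , s≤s z≤n , leftProduct m columns , evaluates-to-ΠV , each-occurs-suc-d
  where
  columns : Fin (suc m) → Factorization (suc m)
  columns = diagonalFactorizations leaf Ws

  evaluates-to-ΠV : eval _*_ (leftProduct m columns) ≡ Π _*_ m V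
  evaluates-to-ΠV = eval-leftProduct _*_ m columns V λ i →
    trans (eval-diagonalFactorizations _*_ leaf Ws i) (𝕎⇝V i)

  each-occurs-suc-d : ∀ a → occurrences a (leftProduct m columns) ≡ suc d
  each-occurs-suc-d a =
    trans (occurrences-leftProduct a m columns)
      (trans (∑-occurrences-diagonalFactorizations leaf Ws Ws-perm a)
        (cong (_+ d) (∑-occurrences-permutation 𝕎 (λ eq → eq) a)))
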